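{- Let $U_a, U_b$ be sets, $R_a \subseteq U_a \times U_b$, $R_b \subseteq U_b \times U_a$, and let $O : \{\mathrm{true}, \mathrm{false}\} \to \{\mathrm{true}, \mathrm{false}\}$ be a unary propositional operator. Define the predicates $q(x) \equiv \exists y \in U_b.\,[R_a(x,y) \wedge R_b(y,x)]$ and $p(x) \equiv O(q(x))$ on $U_a$. Let $\mathcal{P}$ be a class of predicates on $U_a$ containing $p$, and suppose that for every predicate $p' \in \mathcal{P}$ there is $x_0 \in U_a$ such that (i) for every $y \in U_b$ with $R_a(x_0,y)$ we have $\{x \in U_a \mid R_b(y,x)\} = p'$, and (ii) there exists $y \in U_b$ with $R_a(x_0, y)$. Then $O$ has a fixpoint, i.e. there is a truth value $v$ with $O(v) = v$.
   Context: Predicates on a set are subsets; truth values are classical. Condition (i) says "$x_0$ believes that $y$ assumes $p'$". -}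

module Defs where

open import Data.Bool using (Bool; true; false; _∧_)
open import Data.Product using (∃; _×_; _,_)
open import Relation.Binary.PropositionalEquality using (_≡_)
open import Function.Bundles using (_⇔_)

Pred₂ : Set → Set
Pred₂ A = A → Bool

_≐_ : {A : Set} → Pred₂ A → Pred₂ A → Set
p ≐ p' = ∀ x → p x ≡ p' x

IsQ : {Ua Ub : Set} → (Ua → Ub → Bool) → (Ub → Ua → Bool) → Pred₂ Ua → Set
IsQ {Ua} {Ub} Ra Rb q =
  ∀ (x : Ua) → (q x ≡ true) ⇔ ∃ λ (y : Ub) → (Ra x y ≡ true) × (Rb y x ≡ true)

-- Diagonalisation: pick x₀ for the predicate p = O ∘ q itself.  Every
-- R_a-successor y of x₀ has R_b(y, x₀) = p(x₀), and such a y exists, so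
-- q(x₀) holds exactly when p(x₀) = O(q(x₀)) does; thus q(x₀) is a fixpoint of O.
module Submission where

open import Defs
open import Data.Bool using (Bool; true)
open import Data.Bool.Properties using (⇔→≡)
open import Data.Product using (∃; Σ; _×_; _,_)
open import Relation.Binary.PropositionalEquality using (_≡_; sym; trans)
open import Function.Bundles using (_⇔_; mk⇔)
open import Function.Construct.Composition using (_⇔-∘_)
open import Function.Construct.Symmetry using (⇔-sym)

module _ {Ua Ub : Set} (Ra : Ua → Ub → Bool) (Rb : Ub → Ua → Bool) where

  diagonal⇔ : (p : Pred₂ Ua) (x₀ : Ua) →
              (∀ y → Ra x₀ y ≡ true → (λ x → Rb y x) ≐ p) →
              ∃ (λ y → Ra x₀ y ≡ true) →
              (∃ λ y → (Ra x₀ y ≡ true) × (Rb y x₀ ≡ true)) ⇔ (p x₀ ≡ true)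
  diagonal⇔ p x₀ assumes (y₀ , ra₀) = mk⇔
    (λ (y , ra , rb) → trans (sym (assumes y ra x₀)) rb)
    (λ px₀ → y₀ , ra₀ , trans (assumes y₀ ra₀ x₀) px₀)

  diagonal-fixpoint : (O : Bool → Bool) (q : Pred₂ Ua) → IsQ Ra Rb q →
                      (x₀ : Ua) →
                      (∀ y → Ra x₀ y ≡ true → (λ x → Rb y x) ≐ (λ x → O (q x))) →
                      ∃ (λ y → Ra x₀ y ≡ true) →
                      O (q x₀) ≡ q x₀
  diagonal-fixpoint O q isQ x₀ assumes nonempty =
    ⇔→≡ (⇔-sym (diagonal⇔ (λ x → O (q x)) x₀ assumes nonempty ⇔-∘ isQ x₀))

lemma2 : (Ua Ub : Set) (Ra : Ua → Ub → Bool) (Rb : Ub → Ua → Bool)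
         (O : Bool → Bool) (q : Pred₂ Ua) → IsQ Ra Rb q →
         (𝒫 : Pred₂ Ua → Set) → 𝒫 (λ x → O (q x)) →
         (∀ p' → 𝒫 p' → Σ Ua λ x₀ →
            (∀ y → Ra x₀ y ≡ true → (λ x → Rb y x) ≐ p')
            × ∃ λ y → Ra x₀ y ≡ true) →
         ∃ λ (v : Bool) → O v ≡ v
lemma2 Ua Ub Ra Rb O q isQ 𝒫 p∈𝒫 realised
  with realised (λ x → O (q x)) p∈𝒫
... | x₀ , assumes , nonempty =
  q x₀ , diagonal-fixpoint Ra Rb O q isQ x₀ assumes nonempty
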